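{- Let $G$ be a simple graph with $m(G)$ edges and arranged degree sequence $d_1\ge d_2\ge\cdots\ge d_n$. Then $$\nu(G)\ge\min\Big\{k\ge 0,\ 2k\le n\ :\ \sum_{i=1}^k 2d_i+\sum_{i=k+1}^{2k}d_i\ge 2m(G)\Big\}.$$
   Context: $\nu(G)$ denotes the matching number of $G$, i.e., the maximum number of pairwise disjoint edges in $G$. -}

module Defs where

open import Data.Nat using (ℕ; _+_; _*_; _≤_)
open import Data.Bool using (Bool; true; false; T)
open import Data.Fin using (Fin)
open import Data.Nat.ListAction using (sum)
open import Data.List using (List; []; _∷_; length; filter; map; take; drop; allFin; concatMap)
open import Data.List.Relation.Unary.All using (All)
open import Data.Product using (_×_; _,_; Σ)
open import Relation.Binary.PropositionalEquality using (_≡_; _≢_)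
open import Relation.Nullary using (¬_)
open import Relation.Nullary.Decidable using (does)
open import Data.Fin.Properties using (_<?_)
open import Data.Bool using (_∧_)

record SimpleGraph (n : ℕ) : Set where
  field
    adj       : Fin n → Fin n → Bool
    adj-sym   : ∀ i j → adj i j ≡ adj j i
    adj-irrefl : ∀ i → adj i i ≡ false
open SimpleGraph public

degree : ∀ {n} → SimpleGraph n → Fin n → ℕ
degree {n} G i = length (filter (λ j → T? (adj G i j)) (allFin n))
  where open import Data.Bool.Properties using (T?)

edges : ∀ {n} → SimpleGraph n → List (Fin n × Fin n)
edges {n} G =
  concatMap (λ i → map (λ j → (i , j))
              (filter (λ j → T? (does (i <? j) ∧ adj G i j)) (allFin n)))
            (allFin n)
  where open import Data.Bool.Properties using (T?)

numEdges : ∀ {n} → SimpleGraph n → ℕ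
numEdges G = length (edges G)

degrees : ∀ {n} → SimpleGraph n → List ℕ
degrees {n} G = map (degree G) (allFin n)

Disjoint : ∀ {n} → Fin n × Fin n → Fin n × Fin n → Set
Disjoint (a , b) (c , d) = a ≢ c × a ≢ d × b ≢ c × b ≢ d

data PairwiseDisjoint {n : ℕ} : List (Fin n × Fin n) → Set where
  []  : PairwiseDisjoint []
  _∷_ : ∀ {e es} → All (Disjoint e) es → PairwiseDisjoint es → PairwiseDisjoint (e ∷ es)

record Matching {n : ℕ} (G : SimpleGraph n) : Set where
  field
    medges   : List (Fin n × Fin n)
    isEdge   : All (λ { (i , j) → T (adj G i j) }) medges
    disjoint : PairwiseDisjoint medges
open Matching public

-- "k ≤ ν(G)": G has a matching with at least k edges (ν = max matching size)
_≤ν_ : ∀ {n} → ℕ → SimpleGraph n → Set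
k ≤ν G = Σ (Matching G) (λ M → k ≤ length (medges M))

-- For the arranged degree sequence ds = d_1 ≥ ... ≥ d_n (as a list):
--   S ds k = Σ_{i=1}^{k} 2 d_i + Σ_{i=k+1}^{2k} d_i
S : List ℕ → ℕ → ℕ
S ds k = 2 * sum (take k ds) + sum (take k (drop k ds))

{-# OPTIONS --safe #-}
module Submission where

-- Take a matching M, leaving the vertex set R uncovered, that admits no augmenting path
-- of length 1 or 3; one exists because each such path enlarges the matching. Then R is
-- independent, so 2m = Σ_{V(M)} d + Σ_R d = Σ_{V(M)} d + Σ_{z ∈ V(M)} out z, where out z
-- is the number of neighbours of z in R. Each edge uv of M can be oriented so that
-- out u + out v ≤ d(u): if u has no neighbour in R, swap u and v; if u has a neighbour x
-- in R, the absence of a 3-augmenting path x u v y forces out v ≤ 1, while v is a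
-- neighbour of u outside R. Hence, with t = |M|, Σ_{V(M)} d ≤ d₁ + … + d_{2t} and
-- Σ_{V(M)} out ≤ d₁ + … + d_t, that is 2m ≤ S ds t, and minimality of k rules out t < k.

open import Defs
import Data.Nat.Properties as ℕₚ
open import Algebra.Properties.CommutativeSemigroup ℕₚ.+-commutativeSemigroup
  using (interchange; x∙yz≈y∙xz; xy∙z≈xz∙y)
open import Data.Bool using (Bool; true; false; T; _∧_)
open import Data.Bool.Properties using (T?)
open import Data.Empty using (⊥-elim)
open import Data.Fin using (Fin) renaming (_<_ to _<ᶠ_)
open import Data.Fin.Properties using (_<?_; _≟_; <-cmp)
open import Data.List
  using (List; []; _∷_; _++_; [_]; map; length; take; drop; filter; concatMap; allFin)
open import Data.List.Membership.Propositional using (_∈_; find; lose)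
open import Data.List.Membership.Propositional.Properties using (∈-∃++; ∈-++⁻)
open import Data.List.Properties using (length-++; length-map; map-++; map-∘; ++-assoc)
open import Data.List.Relation.Binary.Permutation.Propositional
  using (_↭_; ↭-refl; ↭-sym; ↭-trans; ↭-reflexive; ↭-prep; ↭-swap; ↭⇒↭ₛ; module PermutationReasoning)
open import Data.List.Relation.Binary.Permutation.Propositional.Properties
  using (map⁺; ∈-resp-↭; ++⁺ˡ; ++⁺ʳ; ++⁺; shift; shifts; drop-mid; ↭-length; ↭-empty-inv)
import Data.List.Relation.Binary.Permutation.Setoid.Properties as Setoid↭
open import Data.List.Relation.Unary.All as All using (All; []; _∷_)
import Data.List.Relation.Unary.All.Properties as All
open import Data.List.Relation.Unary.AllPairs using (AllPairs; []; _∷_)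
open import Data.List.Relation.Unary.Any using (Any; here; there; any?)
open import Data.List.Relation.Unary.Linked using (Linked)
open import Data.List.Relation.Unary.Linked.Properties using (Linked⇒AllPairs)
open import Data.List.Relation.Unary.Unique.Propositional using (Unique)
open import Data.List.Relation.Unary.Unique.Propositional.Properties using (allFin⁺)
open import Data.Nat using (ℕ; zero; suc; _+_; _*_; _≤_; _<_; _≥_; z≤n; s≤s; _≤?_)
open import Data.Nat.Induction using (<-wellFounded)
open import Data.Nat.ListAction using (sum)
open import Data.Nat.ListAction.Properties using (sum-++; sum-↭)
open import Data.Nat.Properties
  using (+-assoc; +-comm; +-identityʳ; +-suc; +-mono-≤; +-monoˡ-≤; +-monoʳ-≤; *-monoʳ-≤; ≤-trans; ≤-reflexive;
         m≤m+n; m≤n+m; n≤1+n; <⇒≤; ≰⇒>; module ≤-Reasoning)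
open import Data.Product using (Σ; ∃; _×_; _,_; proj₁; proj₂)
open import Data.Sum using (_⊎_; inj₁; inj₂)
open import Function using (_∘_; flip)
open import Induction.WellFounded using (Acc; acc)
open import Relation.Binary.PropositionalEquality
  using (_≡_; _≢_; refl; sym; trans; cong; cong₂; subst; setoid; module ≡-Reasoning)
open import Relation.Binary.Definitions using (tri<; tri≈; tri>)
open import Relation.Nullary using (¬_; Dec; yes; no; contradiction; does; ¬?; _×-dec_)
open import Relation.Nullary.Decidable using (dec-true; dec-false)

variable
  X Y : Set
  n : ℕ

indicator : Bool → ℕ
indicator true  = 1
indicator false = 0

indicator-T : ∀ {b} → T b → indicator b ≡ 1
indicator-T {true} _ = refl

indicator-¬T : ∀ {b} → ¬ T b → indicator b ≡ 0
indicator-¬T {true}  ¬t = contradiction _ ¬t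
indicator-¬T {false} _  = refl

∑ : List X → (X → ℕ) → ℕ
∑ xs f = sum (map f xs)

∑-++ : ∀ xs ys (f : X → ℕ) → ∑ (xs ++ ys) f ≡ ∑ xs f + ∑ ys f
∑-++ xs ys f = trans (cong sum (map-++ f xs ys)) (sum-++ (map f xs) (map f ys))

∑-↭ : ∀ {xs ys} (f : X → ℕ) → xs ↭ ys → ∑ xs f ≡ ∑ ys f
∑-↭ f p = sum-↭ (map⁺ f p)

∑-map : ∀ (g : X → Y) xs (f : Y → ℕ) → ∑ (map g xs) f ≡ ∑ xs (f ∘ g)
∑-map g xs f = cong sum (sym (map-∘ xs))

∑-cong : ∀ xs {f g : X → ℕ} → (∀ x → f x ≡ g x) → ∑ xs f ≡ ∑ xs g
∑-cong []       f≗g = refl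
∑-cong (x ∷ xs) f≗g = cong₂ _+_ (f≗g x) (∑-cong xs f≗g)

∑-mono-≤ : ∀ xs {f g : X → ℕ} → (∀ {x} → x ∈ xs → f x ≤ g x) → ∑ xs f ≤ ∑ xs g
∑-mono-≤ []       f≤g = z≤n
∑-mono-≤ (x ∷ xs) f≤g = +-mono-≤ (f≤g (here refl)) (∑-mono-≤ xs (f≤g ∘ there))

∑-zero : ∀ xs {f : X → ℕ} → (∀ {x} → x ∈ xs → f x ≡ 0) → ∑ xs f ≡ 0
∑-zero []       f≡0 = refl
∑-zero (x ∷ xs) f≡0 = cong₂ _+_ (f≡0 (here refl)) (∑-zero xs (f≡0 ∘ there))

∈⇒≤∑ : ∀ {x xs} (f : X → ℕ) → x ∈ xs → f x ≤ ∑ xs f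
∈⇒≤∑ f (here refl)              = m≤m+n _ _
∈⇒≤∑ {xs = y ∷ ys} f (there x∈) = ≤-trans (∈⇒≤∑ f x∈) (m≤n+m _ (f y))

∑-distrib-+ : ∀ xs (f g : X → ℕ) → ∑ xs (λ x → f x + g x) ≡ ∑ xs f + ∑ xs g
∑-distrib-+ []       f g = refl
∑-distrib-+ (x ∷ xs) f g =
  trans (cong (f x + g x +_) (∑-distrib-+ xs f g)) (interchange (f x) (g x) _ _)

∑-comm : ∀ xs ys (f : X → Y → ℕ) →
  ∑ xs (λ x → ∑ ys (f x)) ≡ ∑ ys (λ y → ∑ xs (λ x → f x y))
∑-comm []       ys f = sym (∑-zero ys (λ _ → refl))
∑-comm (x ∷ xs) ys f = trans (cong (∑ ys (f x) +_) (∑-comm xs ys f))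
                             (sym (∑-distrib-+ ys (f x) (λ y → ∑ xs (λ x → f x y))))

length-filter : ∀ (p : X → Bool) xs → length (filter (T? ∘ p) xs) ≡ ∑ xs (indicator ∘ p)
length-filter p []       = refl
length-filter p (x ∷ xs) with p x
... | true  = cong suc (length-filter p xs)
... | false = length-filter p xs

length-concatMap : ∀ (f : X → List Y) xs → length (concatMap f xs) ≡ ∑ xs (length ∘ f)
length-concatMap f []       = refl
length-concatMap f (x ∷ xs) = trans (length-++ (f x)) (cong (length (f x) +_) (length-concatMap f xs))

∑-indicator-unique≤1 : ∀ {x : X} {xs} (p : X → Bool) → Unique xs →
  (∀ {y} → y ∈ xs → T (p y) → y ≡ x) → ∑ xs (indicator ∘ p) ≤ 1
∑-indicator-unique≤1 p [] only-x = z≤n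
∑-indicator-unique≤1 {xs = y ∷ ys} p (y∉ys ∷ uniq) only-x with T? (p y)
... | no ¬py = ≤-trans (≤-reflexive (cong (_+ ∑ ys (indicator ∘ p)) (indicator-¬T ¬py)))
                       (∑-indicator-unique≤1 p uniq (only-x ∘ there))
... | yes py = ≤-reflexive (cong₂ _+_ (indicator-T py) (∑-zero ys none))
  where
  none : ∀ {z} → z ∈ ys → indicator (p z) ≡ 0
  none {z} z∈ys = indicator-¬T λ pz →
    All.lookup y∉ys z∈ys (trans (only-x (here refl) py) (sym (only-x (there z∈ys) pz)))

Unique-resp-↭ : ∀ {xs ys : List X} → xs ↭ ys → Unique xs → Unique ys
Unique-resp-↭ p = Setoid↭.Unique-resp-↭ (setoid _) (↭⇒↭ₛ p)

Unique-++⁻ˡ : ∀ (xs : List X) {ys} → Unique (xs ++ ys) → Unique xs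
Unique-++⁻ˡ []       _             = []
Unique-++⁻ˡ (x ∷ xs) (x∉ ∷ uniq) = All.++⁻ˡ xs x∉ ∷ Unique-++⁻ˡ xs uniq

Unique-++⁻ʳ : ∀ (xs : List X) {ys} → Unique (xs ++ ys) → Unique ys
Unique-++⁻ʳ []       uniq       = uniq
Unique-++⁻ʳ (x ∷ xs) (_ ∷ uniq) = Unique-++⁻ʳ xs uniq

remove-pair : ∀ {x y : X} {xs} → x ∈ xs → y ∈ xs → x ≢ y → ∃ λ ys → x ∷ y ∷ ys ↭ xs
remove-pair {x = x} x∈ y∈ x≢y with ∈-∃++ x∈
... | as , bs , refl with ∈-resp-↭ (shift x as bs) y∈
...   | here y≡x   = contradiction (sym y≡x) x≢y
...   | there y∈′ with ∈-∃++ y∈′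
...     | cs , ds , eq = cs ++ ds ,
  ↭-trans (↭-prep x (↭-trans (↭-sym (shift _ cs ds)) (↭-reflexive (sym eq)))) (↭-sym (shift x as bs))

↭-pair-shorter : ∀ {x y : X} {ys xs} → x ∷ y ∷ ys ↭ xs → length ys < length xs
↭-pair-shorter {ys = ys} p = ≤-trans (n≤1+n (suc (length ys))) (≤-reflexive (↭-length p))

take-+ : ∀ k l (xs : List X) → take (k + l) xs ≡ take k xs ++ take l (drop k xs)
take-+ zero    l       xs       = refl
take-+ (suc k) zero    []       = refl
take-+ (suc k) (suc l) []       = refl
take-+ (suc k) l       (x ∷ xs) = cong (x ∷_) (take-+ k l xs)

sum-take-suc≤ : ∀ {d} ys l → All (_≤ d) ys → sum (take (suc l) ys) ≤ d + sum (take l ys)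
sum-take-suc≤ []       l       _            = z≤n
sum-take-suc≤ (y ∷ ys) zero    (y≤d ∷ _)    = +-monoˡ-≤ 0 y≤d
sum-take-suc≤ {d} (y ∷ ys) (suc l) (y≤d ∷ ys≤d) = begin
  y + sum (take (suc l) ys)   ≤⟨ +-monoʳ-≤ y (sum-take-suc≤ ys l ys≤d) ⟩
  y + (d + sum (take l ys))   ≡⟨ x∙yz≈y∙xz y d _ ⟩
  d + (y + sum (take l ys))   ∎
  where open ≤-Reasoning

sum-take-≤-∷ : ∀ {d} ys l → All (_≤ d) ys → sum (take l ys) ≤ sum (take l (d ∷ ys))
sum-take-≤-∷ ys zero    _    = z≤n
sum-take-≤-∷ ys (suc l) ys≤d = sum-take-suc≤ ys l ys≤d

sum≤sum-take : ∀ {ds} → AllPairs _≥_ ds → ∀ xs {ys} → xs ++ ys ↭ ds →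
  sum xs ≤ sum (take (length xs) ds)
sum≤sum-take {[]}     _ []       p = z≤n
sum≤sum-take {[]}     _ (x ∷ xs) p with () ← ↭-empty-inv p
sum≤sum-take {d ∷ ds} (d≥ds ∷ sorted) xs {ys} p
  with ∈-++⁻ xs (∈-resp-↭ (↭-sym p) (here refl))
... | inj₁ d∈xs with ∈-∃++ d∈xs
...   | as , bs , refl = begin
  sum (as ++ d ∷ bs)                          ≡⟨ sum-↭ (shift d as bs) ⟩
  d + sum (as ++ bs)                          ≤⟨ +-monoʳ-≤ d (sum≤sum-take sorted (as ++ bs) rest↭) ⟩
  d + sum (take (length (as ++ bs)) ds)       ≡⟨ cong (λ l → sum (take l (d ∷ ds))) (↭-length (shift d as bs)) ⟨
  sum (take (length (as ++ d ∷ bs)) (d ∷ ds)) ∎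
  where
  open ≤-Reasoning
  rest↭ : (as ++ bs) ++ ys ↭ ds
  rest↭ = ↭-trans (↭-reflexive (++-assoc as bs ys))
    (drop-mid as [] (↭-trans (↭-reflexive (sym (++-assoc as (d ∷ bs) ys))) p))
sum≤sum-take {d ∷ ds} (d≥ds ∷ sorted) xs {ys} p | inj₂ d∈ys with ∈-∃++ d∈ys
...   | as , bs , refl =
  ≤-trans (sum≤sum-take sorted xs rest↭) (sum-take-≤-∷ ds (length xs) d≥ds)
  where
  rest↭ : xs ++ as ++ bs ↭ ds
  rest↭ = ↭-trans (↭-reflexive (sym (++-assoc xs as bs)))
    (drop-mid (xs ++ as) [] (↭-trans (↭-reflexive (++-assoc xs as (d ∷ bs))) p))

Edge : ℕ → Set
Edge n = Fin n × Fin n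

endpoints : List (Edge n) → List (Fin n)
endpoints []             = []
endpoints ((u , v) ∷ es) = u ∷ v ∷ endpoints es

endpoints-++ : ∀ (es fs : List (Edge n)) → endpoints (es ++ fs) ≡ endpoints es ++ endpoints fs
endpoints-++ []             fs = refl
endpoints-++ ((u , v) ∷ es) fs = cong (λ vs → u ∷ v ∷ vs) (endpoints-++ es fs)

length-endpoints : ∀ (es : List (Edge n)) → length (endpoints es) ≡ length es + length es
length-endpoints []       = refl
length-endpoints (e ∷ es) = cong suc (trans (cong suc (length-endpoints es)) (sym (+-suc _ _)))

∈⇒∈-endpoints : ∀ {u v : Fin n} {es} → (u , v) ∈ es → u ∈ endpoints es × v ∈ endpoints es
∈⇒∈-endpoints (here refl) = here refl , there (here refl)
∈⇒∈-endpoints {es = _ ∷ _} (there e∈) =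
  let u∈ , v∈ = ∈⇒∈-endpoints e∈ in there (there u∈) , there (there v∈)

∑-endpoints : ∀ (es : List (Edge n)) f → ∑ (endpoints es) f ≡ ∑ es (λ (u , v) → f u + f v)
∑-endpoints []             f = refl
∑-endpoints ((u , v) ∷ es) f = trans (sym (+-assoc (f u) (f v) _)) (cong (f u + f v +_) (∑-endpoints es f))

heads++tails↭endpoints : ∀ (es : List (Edge n)) → map proj₁ es ++ map proj₂ es ↭ endpoints es
heads++tails↭endpoints []             = ↭-refl
heads++tails↭endpoints ((u , v) ∷ es) = ↭-prep u (↭-trans (shift v (map proj₁ es) (map proj₂ es))
                                                       (↭-prep v (heads++tails↭endpoints es)))

endpoints-map-↭ : ∀ (o : Edge n → Edge n) → (∀ e → endpoints [ o e ] ↭ endpoints [ e ]) →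
  ∀ es → endpoints (map o es) ↭ endpoints es
endpoints-map-↭ o o↭ []       = ↭-refl
endpoints-map-↭ o o↭ (e ∷ es) = ++⁺ (o↭ e) (endpoints-map-↭ o o↭ es)

Unique-endpoints⇒PairwiseDisjoint : ∀ (es : List (Edge n)) → Unique (endpoints es) → PairwiseDisjoint es
Unique-endpoints⇒PairwiseDisjoint []             _ = []
Unique-endpoints⇒PairwiseDisjoint ((u , v) ∷ es) ((_ ∷ u∉) ∷ v∉ ∷ uniq) =
  All.tabulate disjoint-from-uv ∷ Unique-endpoints⇒PairwiseDisjoint es uniq
  where
  disjoint-from-uv : ∀ {e} → e ∈ es → Disjoint (u , v) e
  disjoint-from-uv e∈ = let c∈ , d∈ = ∈⇒∈-endpoints e∈ in
    All.lookup u∉ c∈ , All.lookup u∉ d∈ , All.lookup v∉ c∈ , All.lookup v∉ d∈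

module _ (G : SimpleGraph n) where

  V : List (Fin n)
  V = allFin n

  A : Fin n → Fin n → ℕ
  A i j = indicator (adj G i j)

  A<  : Fin n → Fin n → ℕ
  A< i j = indicator (does (i <? j) ∧ adj G i j)

  degree≡∑A : ∀ i → degree G i ≡ ∑ V (A i)
  degree≡∑A i = length-filter (adj G i) V

  numEdges≡∑A< : numEdges G ≡ ∑ V (λ i → ∑ V (A< i))
  numEdges≡∑A< = trans (length-concatMap _ V) (∑-cong V λ i →
    trans (length-map _ (filter _ V)) (length-filter (λ j → does (i <? j) ∧ adj G i j) V))

  A<-< : ∀ {i j} → i <ᶠ j → A< i j ≡ A i j
  A<-< {i} {j} i<j = cong (λ b → indicator (b ∧ adj G i j)) (dec-true (i <? j) i<j)

  A<-≮ : ∀ {i j} → ¬ i <ᶠ j → A< i j ≡ 0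
  A<-≮ {i} {j} i≮j = cong (λ b → indicator (b ∧ adj G i j)) (dec-false (i <? j) i≮j)

  A≡A<+A<ᵀ : ∀ i j → A i j ≡ A< i j + A< j i
  A≡A<+A<ᵀ i j with <-cmp i j
  ... | tri< i<j _ j≮i = sym (trans (cong₂ _+_ (A<-< i<j) (A<-≮ j≮i)) (+-identityʳ _))
  ... | tri> i≮j _ j<i = trans (cong indicator (adj-sym G i j)) (sym (cong₂ _+_ (A<-≮ i≮j) (A<-< j<i)))
  ... | tri≈ i≮j refl _ = trans (cong indicator (adj-irrefl G i)) (sym (cong₂ _+_ (A<-≮ i≮j) (A<-≮ i≮j)))

  handshake : ∑ V (degree G) ≡ numEdges G + numEdges G
  handshake = begin
    ∑ V (degree G)
      ≡⟨ ∑-cong V degree≡∑A ⟩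
    ∑ V (λ i → ∑ V (A i))
      ≡⟨ ∑-cong V (λ i → ∑-cong V (A≡A<+A<ᵀ i)) ⟩
    ∑ V (λ i → ∑ V (λ j → A< i j + A< j i))
      ≡⟨ ∑-cong V (λ i → ∑-distrib-+ V (A< i) _) ⟩
    ∑ V (λ i → ∑ V (A< i) + ∑ V (λ j → A< j i))
      ≡⟨ ∑-distrib-+ V _ _ ⟩
    ∑ V (λ i → ∑ V (A< i)) + ∑ V (λ i → ∑ V (λ j → A< j i))
      ≡⟨ cong (∑ V (λ i → ∑ V (A< i)) +_) (∑-comm V V (λ i j → A< j i)) ⟩
    ∑ V (λ i → ∑ V (A< i)) + ∑ V (λ i → ∑ V (A< i))
      ≡⟨ cong₂ _+_ numEdges≡∑A< numEdges≡∑A< ⟨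
    numEdges G + numEdges G
      ∎
    where open ≡-Reasoning

  ∑degree≤sum-take : ∀ {ds} → ds ↭ degrees G → AllPairs _≥_ ds → ∀ xs {ys} → xs ++ ys ↭ V →
    ∑ xs (degree G) ≤ sum (take (length xs) ds)
  ∑degree≤sum-take {ds} ds↭ sorted xs {ys} p = begin
    ∑ xs (degree G)                           ≤⟨ sum≤sum-take sorted (map (degree G) xs) degrees↭ ⟩
    sum (take (length (map (degree G) xs)) ds) ≡⟨ cong (λ l → sum (take l ds)) (length-map (degree G) xs) ⟩
    sum (take (length xs) ds)                  ∎
    where
    open ≤-Reasoning
    degrees↭ : map (degree G) xs ++ map (degree G) ys ↭ ds
    degrees↭ = ↭-trans (↭-reflexive (sym (map-++ (degree G) xs ys))) (↭-trans (map⁺ (degree G) p) (↭-sym ds↭))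

  IsEdge : Edge n → Set
  IsEdge (u , v) = T (adj G u v)

  record Partition : Set where
    field
      matching : List (Edge n)
      free     : List (Fin n)
      covers   : endpoints matching ++ free ↭ V
      onEdges  : All IsEdge matching

    unique : Unique (endpoints matching ++ free)
    unique = Unique-resp-↭ (↭-sym covers) (allFin⁺ n)

  open Partition

  toMatching : Partition → Matching G
  toMatching p = record
    { medges   = matching p
    ; isEdge   = onEdges p
    ; disjoint = Unique-endpoints⇒PairwiseDisjoint (matching p) (Unique-++⁻ˡ _ (unique p))
    }

  AdjacentIn : List (Fin n) → Set
  AdjacentIn vs = Any (λ w → Any (T ∘ adj G w) vs) vs

  -- The path x u v y with x, y ∈ vs, which augments when vs are the free vertices.
  Augmentable : List (Fin n) → Edge n → Set
  Augmentable vs (u , v) = Any (λ x → Any (λ y → x ≢ y × T (adj G u x) × T (adj G v y)) vs) vs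

  Stuck : Partition → Set
  Stuck p = ¬ AdjacentIn (free p) × ¬ Any (Augmentable (free p)) (matching p)

  Improvement : Partition → Set
  Improvement p = Σ Partition λ p′ → length (free p′) < length (free p)

  extend : ∀ p → AdjacentIn (free p) → Improvement p
  extend p adjacent with find adjacent
  ... | w , w∈ , z-adj with find z-adj
  ... | z , z∈ , wz with remove-pair w∈ z∈ (λ { refl → subst T (adj-irrefl G w) wz })
  ... | rest , wz↭ = record
    { matching = (w , z) ∷ matching p
    ; free     = rest
    ; covers   = ↭-trans (shifts (w ∷ z ∷ []) (endpoints (matching p)))
                         (↭-trans (++⁺ˡ (endpoints (matching p)) wz↭) (covers p))
    ; onEdges  = wz ∷ onEdges p
    } , ↭-pair-shorter wz↭

  augment : ∀ p → Any (Augmentable (free p)) (matching p) → Improvement p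
  augment p augmentable with find augmentable
  ... | (u , v) , uv∈ , xy-path with find xy-path
  ... | x , x∈ , y-path with find y-path
  ... | y , y∈ , x≢y , ux , vy with ∈-∃++ uv∈ | remove-pair x∈ y∈ x≢y
  ... | as , bs , M≡ | rest , xy↭ = record
    { matching = as ++ (u , x) ∷ (v , y) ∷ bs
    ; free     = rest
    ; covers   = ↭-trans covers′ (covers p)
    ; onEdges  = All.++⁺ (All.++⁻ˡ as uvs) (ux ∷ vy ∷ All.tail (All.++⁻ʳ as uvs))
    } , ↭-pair-shorter xy↭
    where
    uvs : All IsEdge (as ++ (u , v) ∷ bs)
    uvs = subst (All IsEdge) M≡ (onEdges p)
    reassoc : ∀ es rest → endpoints (as ++ es) ++ rest ≡ endpoints as ++ (endpoints es ++ rest)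
    reassoc es rest = trans (cong (_++ rest) (endpoints-++ as es)) (++-assoc (endpoints as) _ rest)
    covers′ : endpoints (as ++ (u , x) ∷ (v , y) ∷ bs) ++ rest ↭ endpoints (matching p) ++ free p
    covers′ = begin
      endpoints (as ++ (u , x) ∷ (v , y) ∷ bs) ++ rest
        ≡⟨ reassoc _ rest ⟩
      endpoints as ++ u ∷ x ∷ v ∷ y ∷ endpoints bs ++ rest
        ↭⟨ ++⁺ˡ (endpoints as) (↭-prep u (↭-swap x v ↭-refl)) ⟩
      endpoints as ++ u ∷ v ∷ x ∷ y ∷ endpoints bs ++ rest
        ↭⟨ ++⁺ˡ (endpoints as) (↭-prep u (↭-prep v (shifts (x ∷ y ∷ []) (endpoints bs)))) ⟩
      endpoints as ++ u ∷ v ∷ endpoints bs ++ x ∷ y ∷ rest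
        ↭⟨ ++⁺ˡ (endpoints as) (↭-prep u (↭-prep v (++⁺ˡ (endpoints bs) xy↭))) ⟩
      endpoints as ++ u ∷ v ∷ endpoints bs ++ free p
        ≡⟨ reassoc _ (free p) ⟨
      endpoints (as ++ (u , v) ∷ bs) ++ free p
        ≡⟨ cong (λ M → endpoints M ++ free p) M≡ ⟨
      endpoints (matching p) ++ free p
        ∎
      where open PermutationReasoning

  augmentable? : ∀ vs e → Dec (Augmentable vs e)
  augmentable? vs (u , v) =
    any? (λ x → any? (λ y → ¬? (x ≟ y) ×-dec T? (adj G u x) ×-dec T? (adj G v y)) vs) vs

  stuck-or-improvable : ∀ p → Stuck p ⊎ Improvement p
  stuck-or-improvable p with any? (λ w → any? (T? ∘ adj G w) (free p)) (free p)
  ... | yes adjacent = inj₂ (extend p adjacent)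
  ... | no independent with any? (augmentable? (free p)) (matching p)
  ... | yes augmentable = inj₂ (augment p augmentable)
  ... | no  maximal     = inj₁ (independent , maximal)

  settle : ∀ p → Acc _<_ (length (free p)) → Σ Partition Stuck
  settle p (acc smaller) with stuck-or-improvable p
  ... | inj₁ stuck          = p , stuck
  ... | inj₂ (p′ , shorter) = settle p′ (smaller shorter)

  emptyPartition : Partition
  emptyPartition = record { matching = [] ; free = V ; covers = ↭-refl ; onEdges = [] }

  module _ (p : Partition) (stuck : Stuck p) where

    M : List (Edge n)
    M = matching p

    R : List (Fin n)
    R = free p

    D : Fin n → ℕ
    D = degree G

    independent : ¬ AdjacentIn R
    independent = proj₁ stuck

    maximal : ¬ Any (Augmentable R) M
    maximal = proj₂ stuck

    out : Fin n → ℕ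
    out z = ∑ R (A z)

    degree-split : ∀ z → D z ≡ ∑ (endpoints M) (A z) + out z
    degree-split z = trans (degree≡∑A z) (trans (∑-↭ (A z) (↭-sym (covers p))) (∑-++ (endpoints M) R (A z)))

    out≤degree : ∀ z → out z ≤ D z
    out≤degree z = ≤-trans (m≤n+m _ _) (≤-reflexive (sym (degree-split z)))

    free-independent : ∀ {w z} → w ∈ R → z ∈ R → A w z ≡ 0
    free-independent w∈ z∈ = indicator-¬T λ wz → independent (lose w∈ (lose z∈ wz))

    ∑free-degree≡∑matched-out : ∑ R D ≡ ∑ (endpoints M) out
    ∑free-degree≡∑matched-out = begin
      ∑ R D
        ≡⟨ ∑-cong R degree-split ⟩
      ∑ R (λ w → ∑ (endpoints M) (A w) + out w)
        ≡⟨ ∑-distrib-+ R _ out ⟩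
      ∑ R (λ w → ∑ (endpoints M) (A w)) + ∑ R out
        ≡⟨ cong (∑ R (λ w → ∑ (endpoints M) (A w)) +_) (∑-zero R λ w∈ → ∑-zero R (free-independent w∈)) ⟩
      ∑ R (λ w → ∑ (endpoints M) (A w)) + 0
        ≡⟨ +-identityʳ _ ⟩
      ∑ R (λ w → ∑ (endpoints M) (A w))
        ≡⟨ ∑-comm R (endpoints M) A ⟩
      ∑ (endpoints M) (λ z → ∑ R (λ w → A w z))
        ≡⟨ ∑-cong (endpoints M) (λ z → ∑-cong R λ w → cong indicator (adj-sym G w z)) ⟩
      ∑ (endpoints M) out
        ∎
      where open ≡-Reasoning

    twice-edges : numEdges G + numEdges G ≡ ∑ (endpoints M) D + ∑ (endpoints M) out
    twice-edges = begin
      numEdges G + numEdges G              ≡⟨ handshake ⟨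
      ∑ V D                                ≡⟨ ∑-↭ D (covers p) ⟨
      ∑ (endpoints M ++ R) D               ≡⟨ ∑-++ (endpoints M) R D ⟩
      ∑ (endpoints M) D + ∑ R D            ≡⟨ cong (∑ (endpoints M) D +_) ∑free-degree≡∑matched-out ⟩
      ∑ (endpoints M) D + ∑ (endpoints M) out ∎
      where open ≡-Reasoning

    out-partner≤1 : ∀ {u v x} → (u , v) ∈ M → x ∈ R → T (adj G u x) → out v ≤ 1
    out-partner≤1 {u} {v} {x} uv∈ x∈ ux =
      ∑-indicator-unique≤1 (adj G v) (Unique-++⁻ʳ (endpoints M) (unique p)) only-x
      where
      only-x : ∀ {y} → y ∈ R → T (adj G v y) → y ≡ x
      only-x {y} y∈ vy with x ≟ y
      ... | yes x≡y = sym x≡y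
      ... | no  x≢y = ⊥-elim (maximal (lose uv∈ (lose x∈ (lose y∈ (x≢y , ux , vy)))))

    1+out≤degree : ∀ {u v} → (u , v) ∈ M → T (adj G u v) → suc (out u) ≤ D u
    1+out≤degree {u} uv∈ uv = begin
      1 + out u                        ≤⟨ +-monoˡ-≤ (out u) (≤-trans (≤-reflexive (sym (indicator-T uv)))
                                                         (∈⇒≤∑ (A u) (proj₂ (∈⇒∈-endpoints uv∈)))) ⟩
      ∑ (endpoints M) (A u) + out u    ≡⟨ degree-split u ⟨
      D u                              ∎
      where open ≤-Reasoning

    orient : Edge n → Edge n
    orient (u , v) with any? (T? ∘ adj G u) R
    ... | yes _ = u , v
    ... | no  _ = v , u

    orient-↭ : ∀ e → endpoints [ orient e ] ↭ endpoints [ e ]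
    orient-↭ (u , v) with any? (T? ∘ adj G u) R
    ... | yes _ = ↭-refl
    ... | no  _ = ↭-swap v u ↭-refl

    out-oriented≤degree : ∀ {e} → e ∈ M → let (u , v) = orient e in out u + out v ≤ D u
    out-oriented≤degree {u , v} uv∈ with any? (T? ∘ adj G u) R
    ... | yes u-free-adj = let x , x∈ , ux = find u-free-adj in begin
      out u + out v   ≤⟨ +-monoʳ-≤ (out u) (out-partner≤1 uv∈ x∈ ux) ⟩
      out u + 1       ≡⟨ +-comm (out u) 1 ⟩
      suc (out u)     ≤⟨ 1+out≤degree uv∈ (All.lookup (onEdges p) uv∈) ⟩
      D u             ∎
      where open ≤-Reasoning
    ... | no ¬u-free-adj = begin
      out v + out u   ≡⟨ cong (out v +_) (∑-zero R λ x∈ → indicator-¬T λ ux → ¬u-free-adj (lose x∈ ux)) ⟩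
      out v + 0       ≡⟨ +-identityʳ (out v) ⟩
      out v           ≤⟨ out≤degree v ⟩
      D v             ∎
      where open ≤-Reasoning

    module _ {ds : List ℕ} (ds↭ : ds ↭ degrees G) (sorted : AllPairs _≥_ ds) where

      t : ℕ
      t = length M

      M′ : List (Edge n)
      M′ = map orient M

      ∑matched-degree≤ : ∑ (endpoints M) D ≤ sum (take t ds) + sum (take t (drop t ds))
      ∑matched-degree≤ = begin
        ∑ (endpoints M) D                           ≤⟨ ∑degree≤sum-take ds↭ sorted (endpoints M) (covers p) ⟩
        sum (take (length (endpoints M)) ds)        ≡⟨ cong (λ l → sum (take l ds)) (length-endpoints M) ⟩
        sum (take (t + t) ds)                       ≡⟨ cong sum (take-+ t t ds) ⟩
        sum (take t ds ++ take t (drop t ds))       ≡⟨ sum-++ (take t ds) _ ⟩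
        sum (take t ds) + sum (take t (drop t ds))  ∎
        where open ≤-Reasoning

      heads-covers : map proj₁ M′ ++ map proj₂ M′ ++ R ↭ V
      heads-covers = ↭-trans (↭-reflexive (sym (++-assoc (map proj₁ M′) _ R)))
        (↭-trans (++⁺ʳ R (↭-trans (heads++tails↭endpoints M′) (endpoints-map-↭ orient orient-↭ M)))
                 (covers p))

      ∑matched-out≤ : ∑ (endpoints M) out ≤ sum (take t ds)
      ∑matched-out≤ = begin
        ∑ (endpoints M) out
          ≡⟨ ∑-↭ out (endpoints-map-↭ orient orient-↭ M) ⟨
        ∑ (endpoints M′) out
          ≡⟨ ∑-endpoints M′ out ⟩
        ∑ M′ (λ (u , v) → out u + out v)
          ≡⟨ ∑-map orient M _ ⟩
        ∑ M (λ e → let (u , v) = orient e in out u + out v)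
          ≤⟨ ∑-mono-≤ M out-oriented≤degree ⟩
        ∑ M (D ∘ proj₁ ∘ orient)
          ≡⟨ ∑-map orient M (D ∘ proj₁) ⟨
        ∑ M′ (D ∘ proj₁)
          ≡⟨ ∑-map proj₁ M′ D ⟨
        ∑ (map proj₁ M′) D
          ≤⟨ ∑degree≤sum-take ds↭ sorted (map proj₁ M′) heads-covers ⟩
        sum (take (length (map proj₁ M′)) ds)
          ≡⟨ cong (λ l → sum (take l ds)) (trans (length-map proj₁ M′) (length-map orient M)) ⟩
        sum (take t ds)
          ∎
        where open ≤-Reasoning

      2m≤S : 2 * numEdges G ≤ S ds t
      2m≤S = begin
        2 * numEdges G                          ≡⟨ cong (numEdges G +_) (+-identityʳ _) ⟩
        numEdges G + numEdges G                 ≡⟨ twice-edges ⟩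
        ∑ (endpoints M) D + ∑ (endpoints M) out ≤⟨ +-mono-≤ ∑matched-degree≤ ∑matched-out≤ ⟩
        (top + next) + top                      ≡⟨ xy∙z≈xz∙y top next top ⟩
        (top + top) + next                      ≡⟨ cong (λ z → top + z + next) (+-identityʳ top) ⟨
        S ds t                                  ∎
        where
        open ≤-Reasoning
        top next : ℕ
        top  = sum (take t ds)
        next = sum (take t (drop t ds))

theorem5p4 : ∀ {n} (G : SimpleGraph n) (ds : List ℕ) →
    ds ↭ degrees G → Linked _≥_ ds →
    ∀ (k : ℕ) → 2 * k ≤ n → S ds k ≥ 2 * numEdges G →
    (∀ k′ → k′ < k → 2 * k′ ≤ n → ¬ (S ds k′ ≥ 2 * numEdges G)) →
    k ≤ν G
theorem5p4 G ds ds↭ sorted k 2k≤n _ minimal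
  with settle G (emptyPartition G) (<-wellFounded _)
... | p , stuck with k ≤? length (Partition.matching p)
...   | yes k≤t = toMatching G p , k≤t
...   | no  k≰t = contradiction (2m≤S G p stuck ds↭ (Linked⇒AllPairs (flip ≤-trans) sorted))
                                (minimal _ t<k (≤-trans (*-monoʳ-≤ 2 (<⇒≤ t<k)) 2k≤n))
  where
  t<k : length (Partition.matching p) < k
  t<k = ≰⇒> k≰t
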